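{- Let $t,t'$ be terms and $\pi$ a derivation with conclusion $\Gamma\vdash t\colon Q$. (1) If $t\to_{\rhd\beta_v}t'$ then $|\pi|>0$ and there exists a derivation $\pi'$ with conclusion $\Gamma\vdash t'\colon Q$ such that $|\pi'|=|\pi|-1$. (2) If $t\to_{\rhd\sigma}t'$ then $|\pi|>0$ and there exists a derivation $\pi'$ with conclusion $\Gamma\vdash t'\colon Q$ such that $|\pi'|=|\pi|$.
   Context: Terms: $t ::= x \mid \lambda x.t \mid tu$ (up to $\alpha$); values $v ::= x \mid \lambda x.t$; $\mathrm{Fv}(t)$ free variables; $t\{v/x\}$ substitution. Root steps: ($\beta_v$) $(\lambda x.t)v \mapsto t\{v/x\}$, $v$ a value; ($\sigma_1$) $(\lambda x.t)us \mapsto (\lambda x.ts)u$ if $x\notin\mathrm{Fv}(s)$; ($\sigma_3$) $v((\lambda x.s)u)\mapsto(\lambda x.vs)u$ if $v$ a value, $x\notin\mathrm{Fv}(v)$. Balanced contexts $B ::= [\cdot] \mid (\lambda x.B)t \mid Bt \mid tB$; $\to_{\rhd r}$ is the closure of root step $r$ under balanced contexts; $\to_{\rhd\sigma}$ is the union of $\to_{\rhd\sigma_1}$ and $\to_{\rhd\sigma_3}$. Types: positive types are finite multisets $[(P_1,Q_1),\dots,(P_n,Q_n)]$ of pairs of positive types ($\mathbf{0}$ empty, $\uplus$ union). Environments map variables to positive types (finitely many non-$\mathbf{0}$), combined pointwise by $\uplus$. Rules: (ax) $x\colon P\vdash x\colon P$; ($\lambda$) from $\Gamma_i,x\colon P_i\vdash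 t\colon Q_i$ ($1\le i\le n$, $n\ge0$) infer $\biguplus_i\Gamma_i\vdash\lambda x.t\colon[(P_1,Q_1),\dots,(P_n,Q_n)]$; ($@$) from $\Gamma\vdash t\colon[(P,Q)]$ and $\Delta\vdash u\colon P$ infer $\Gamma\uplus\Delta\vdash tu\colon Q$. The size $|\pi|$ of a derivation is the number of $@$ rules in it. -}

module Defs where

open import Data.Nat using (ℕ; zero; suc; _+_)
open import Data.Fin using (Fin; zero; suc)
open import Data.List using (List; []; _∷_; _++_; tabulate)
open import Data.Product using (_×_; _,_)
open import Relation.Binary.PropositionalEquality using (_≡_)
open import Data.Nat using (_≟_)
open import Relation.Nullary using (yes; no)

-- Terms, with de Bruijn indices (so terms are taken up to α).

data Term : Set where
  var : ℕ → Term
  lam : Term → Term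
  app : Term → Term → Term

data Value : Term → Set where
  vVar : ∀ n → Value (var n)
  vLam : ∀ t → Value (lam t)

Ren : Set
Ren = ℕ → ℕ

ext : Ren → Ren
ext ρ zero    = zero
ext ρ (suc n) = suc (ρ n)

rename : Ren → Term → Term
rename ρ (var n)   = var (ρ n)
rename ρ (lam t)   = lam (rename (ext ρ) t)
rename ρ (app t u) = app (rename ρ t) (rename ρ u)

-- weakening: shift all free variables by one (used to put a term
-- under a new binder without capture; this encodes the side
-- conditions x ∉ Fv(s), x ∉ Fv(v) of σ₁ and σ₃)
shift : Term → Term
shift = rename suc

Sub : Set
Sub = ℕ → Term

exts : Sub → Sub
exts σ zero    = var zero
exts σ (suc n) = shift (σ n)

subst : Sub → Term → Term
subst σ (var n)   = σ n
subst σ (lam t)   = lam (subst (exts σ) t)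
subst σ (app t u) = app (subst σ t) (subst σ u)

-- t{v/x} where x is the variable bound by the enclosing λ (index 0)
_[_] : Term → Term → Term
t [ v ] = subst σ t
  where
  σ : Sub
  σ zero    = v
  σ (suc n) = var n

data βv-root : Term → Term → Set where
  βv : ∀ {t v} → Value v → βv-root (app (lam t) v) (t [ v ])

data σ-root : Term → Term → Set where
  -- (λx.t)us ↦ (λx.ts)u
  σ₁ : ∀ {t u s} → σ-root (app (app (lam t) u) s) (app (lam (app t (shift s))) u)
  -- v((λx.s)u) ↦ (λx.vs)u
  σ₃ : ∀ {v s u} → Value v →
       σ-root (app v (app (lam s) u)) (app (lam (app (shift v) s)) u)

-- closure under balanced contexts  B ::= [·] | (λx.B)t | Bt | tB
data Balanced (R : Term → Term → Set) : Term → Term → Set where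
  root   : ∀ {t t'} → R t t' → Balanced R t t'
  lamApp : ∀ {t t' u} → Balanced R t t' → Balanced R (app (lam t) u) (app (lam t') u)
  appL   : ∀ {t t' u} → Balanced R t t' → Balanced R (app t u) (app t' u)
  appR   : ∀ {t u u'} → Balanced R u u' → Balanced R (app t u) (app t u')

_→βv_ : Term → Term → Set
_→βv_ = Balanced βv-root

_→σ_ : Term → Term → Set
_→σ_ = Balanced σ-root

-- Positive types: finite multisets of pairs of positive types.
-- Represented by lists, compared by the (recursive) multiset equality _≈_.

data Ty : Set where
  ⟨_⟩ : List (Ty × Ty) → Ty

𝟎 : Ty
𝟎 = ⟨ [] ⟩

_⊎ᵗ_ : Ty → Ty → Ty
⟨ xs ⟩ ⊎ᵗ ⟨ ys ⟩ = ⟨ xs ++ ys ⟩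

data _≈_ : Ty → Ty → Set
data _~_ : List (Ty × Ty) → List (Ty × Ty) → Set

data _≈_ where
  mset : ∀ {xs ys} → xs ~ ys → ⟨ xs ⟩ ≈ ⟨ ys ⟩

-- bag (multiset) equality of lists, up to _≈_ on the elements
data _~_ where
  nil  : [] ~ []
  cons : ∀ {P Q P' Q' xs ys₁ ys₂} → P ≈ P' → Q ≈ Q' → xs ~ (ys₁ ++ ys₂) →
         ((P , Q) ∷ xs) ~ (ys₁ ++ ((P' , Q') ∷ ys₂))

Env : Set
Env = ℕ → Ty

∅ : Env
∅ _ = 𝟎

_⊎ᵉ_ : Env → Env → Env
(Γ ⊎ᵉ Δ) n = Γ n ⊎ᵗ Δ n

_≈ᵉ_ : Env → Env → Set
Γ ≈ᵉ Δ = ∀ n → Γ n ≈ Δ n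

single : ℕ → Ty → Env
single x P n with n ≟ x
... | yes _ = P
... | no _  = 𝟎

-- the environment of the body of a binder, with the bound variable removed
tailᵉ : Env → Env
tailᵉ Γ n = Γ (suc n)

⨄ : (n : ℕ) → (Fin n → Env) → Env
⨄ zero    Γs = ∅
⨄ (suc n) Γs = Γs zero ⊎ᵉ ⨄ n (λ i → Γs (suc i))

-- Typing derivations
--  (λ): from Γᵢ , x : Pᵢ ⊢ t : Qᵢ (1 ≤ i ≤ n) infer ⨄ Γᵢ ⊢ λx.t : [(P₁,Q₁),…,(Pₙ,Qₙ)].
--  Here the i-th premise has environment Δᵢ with Pᵢ = Δᵢ 0 and Γᵢ = tailᵉ Δᵢ.
--  (@): the argument type P is matched up to multiset equality.

data _⊢_∶_ : Env → Term → Ty → Set where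
  ax  : ∀ x P → single x P ⊢ var x ∶ P
  lm  : ∀ {t} (n : ℕ) (Δs : Fin n → Env) (Qs : Fin n → Ty) →
        ((i : Fin n) → Δs i ⊢ t ∶ Qs i) →
        ⨄ n (λ i → tailᵉ (Δs i)) ⊢ lam t ∶ ⟨ tabulate (λ i → (Δs i zero , Qs i)) ⟩
  ap  : ∀ {Γ Δ t u P P' Q} → Γ ⊢ t ∶ ⟨ (P , Q) ∷ [] ⟩ → Δ ⊢ u ∶ P' → P ≈ P' →
        (Γ ⊎ᵉ Δ) ⊢ app t u ∶ Q

sumFin : (n : ℕ) → (Fin n → ℕ) → ℕ
sumFin zero    f = 0
sumFin (suc n) f = f zero + sumFin n (λ i → f (suc i))

size : ∀ {Γ t Q} → Γ ⊢ t ∶ Q → ℕ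
size (ax x P)        = 0
size (lm n Δs Qs ds) = sumFin n (λ i → size (ds i))
size (ap d e _)      = suc (size d + size e)

module Submission where

-- In this non-idempotent system a value typed with a multiset P ⊎ P′ splits into
-- derivations of P and P′ whose environments and sizes add up (a variable is split
-- trivially, a λ-abstraction by distributing the premises of its λ rule).  Hence
-- substituting a value for a variable costs no @ rule: in a βv step the derivation of
-- the body absorbs the pieces of the argument, and only the @ rule of the redex is
-- lost.  The σ rules merely regroup the same @ rules around a λ whose type is a
-- singleton, so the size is unchanged.  Both facts pass through balanced contexts,
-- because a λ of singleton type has exactly one premise.

open import Defs
open import Algebra.Bundles using (CommutativeMonoid)
open import Algebra.Structures.Biased using (isCommutativeMonoidˡ)
import Algebra.Construct.Pointwise as Pointwise
import Algebra.Properties.CommutativeSemigroup as CommutativeSemigroupProperties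
open import Data.Empty using (⊥-elim)
open import Data.Fin using (Fin; zero; suc)
open import Data.List using (List; []; _∷_; _++_; tabulate)
open import Data.List.Properties using (++-assoc; ++-identityʳ; ∷-injective; ++-conicalˡ; ++-conicalʳ)
open import Data.Nat using (ℕ; zero; suc; _+_; _<_; _∸_; s≤s; z≤n; _≟_)
open import Data.Nat.Properties
  using (suc-injective; +-assoc; +-suc; +-identityʳ; +-commutativeSemigroup; m+n∸m≡n)
open import Data.Product using (_×_; _,_; Σ-syntax)
open import Data.Sum using (_⊎_; inj₁; inj₂)
open import Data.Vec.Functional using () renaming (_∷_ to _∷ᶠ_)
open import Function using (_∘_)
open import Relation.Nullary using (Dec; yes; no)
open import Relation.Binary.PropositionalEquality as ≡
  using (_≡_; _≢_; _≗_; refl; sym; trans; cong; cong₂)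

open CommutativeSemigroupProperties +-commutativeSemigroup
  using () renaming (interchange to +-interchange; x∙yz≈y∙xz to +-left-comm; xy∙z≈xz∙y to +-right-comm)

≈-refl : ∀ {P} → P ≈ P
~-refl : ∀ {xs} → xs ~ xs
≈-refl {⟨ _ ⟩} = mset ~-refl
~-refl {[]}    = nil
~-refl {_ ∷ _} = cons {ys₁ = []} ≈-refl ≈-refl ~-refl

≈-reflexive : ∀ {P Q} → P ≡ Q → P ≈ Q
≈-reflexive refl = ≈-refl

~-reflexive : ∀ {xs ys} → xs ≡ ys → xs ~ ys
~-reflexive refl = ~-refl

~-insert : ∀ {P Q P′ Q′} ys₁ {ys₂ zs} → P ≈ P′ → Q ≈ Q′ → (ys₁ ++ ys₂) ~ zs →
           (ys₁ ++ (P , Q) ∷ ys₂) ~ ((P′ , Q′) ∷ zs)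
~-insert []       p q r                      = cons {ys₁ = []} p q r
~-insert (_ ∷ ys₁) p q (cons {ys₁ = zs₁} a b r) = cons {ys₁ = _ ∷ zs₁} a b (~-insert ys₁ p q r)

≈-sym : ∀ {P Q} → P ≈ Q → Q ≈ P
~-sym : ∀ {xs ys} → xs ~ ys → ys ~ xs
≈-sym (mset r) = mset (~-sym r)
~-sym nil                      = nil
~-sym (cons {ys₁ = ys₁} p q r) = ~-insert ys₁ (≈-sym p) (≈-sym q) (~-sym r)

insert-remove-comm : ∀ {A : Set} (a₁ a₂ b₁ b₂ : List A) (z w : A) → a₁ ++ a₂ ≡ b₁ ++ z ∷ b₂ →
  Σ[ c₁ ∈ List A ] Σ[ c₂ ∈ List A ] Σ[ d₁ ∈ List A ] Σ[ d₂ ∈ List A ]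
    (a₁ ++ w ∷ a₂ ≡ c₁ ++ z ∷ c₂) × (c₁ ++ c₂ ≡ d₁ ++ w ∷ d₂) × (d₁ ++ d₂ ≡ b₁ ++ b₂)
insert-remove-comm [] a₂ b₁ b₂ z w eq = w ∷ b₁ , b₂ , [] , b₁ ++ b₂ , cong (w ∷_) eq , refl , refl
insert-remove-comm (a ∷ a₁) a₂ [] b₂ z w eq with ∷-injective eq
... | refl , eq′ = [] , a₁ ++ w ∷ a₂ , a₁ , a₂ , refl , refl , eq′
insert-remove-comm (a ∷ a₁) a₂ (b ∷ b₁) b₂ z w eq with ∷-injective eq
... | refl , eq′ with insert-remove-comm a₁ a₂ b₁ b₂ z w eq′
... | c₁ , c₂ , d₁ , d₂ , e₁ , e₂ , e₃ =
  a ∷ c₁ , c₂ , a ∷ d₁ , d₂ , cong (a ∷_) e₁ , cong (a ∷_) e₂ , cong (a ∷_) e₃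

~-remove : ∀ ys₁ {Y₁ Y₂ ys₂ zs} → (ys₁ ++ (Y₁ , Y₂) ∷ ys₂) ~ zs →
  Σ[ zs₁ ∈ List (Ty × Ty) ] Σ[ Z₁ ∈ Ty ] Σ[ Z₂ ∈ Ty ] Σ[ zs₂ ∈ List (Ty × Ty) ]
    (zs ≡ zs₁ ++ (Z₁ , Z₂) ∷ zs₂) × (Y₁ ≈ Z₁) × (Y₂ ≈ Z₂) × ((ys₁ ++ ys₂) ~ (zs₁ ++ zs₂))
~-remove [] (cons {ys₁ = a₁} {ys₂ = a₂} p q r) = a₁ , _ , _ , a₂ , refl , p , q , r
~-remove (_ ∷ ws) (cons {P' = W₁} {Q' = W₂} {ys₁ = a₁} {ys₂ = a₂} p q r)
  with ~-remove ws r
... | b₁ , Z₁ , Z₂ , b₂ , eq , y₁ , y₂ , r′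
  with insert-remove-comm a₁ a₂ b₁ b₂ (Z₁ , Z₂) (W₁ , W₂) eq
... | c₁ , c₂ , d₁ , d₂ , e₁ , e₂ , e₃ =
  c₁ , Z₁ , Z₂ , c₂ , e₁ , y₁ , y₂ ,
  ≡.subst (_ ~_) (sym e₂) (cons {ys₁ = d₁} p q (≡.subst (_ ~_) (sym e₃) r′))

≈-trans : ∀ {A B C} → A ≈ B → B ≈ C → A ≈ C
~-trans : ∀ {xs ys zs} → xs ~ ys → ys ~ zs → xs ~ zs
≈-trans (mset r) (mset s) = mset (~-trans r s)
~-trans nil s = s
~-trans (cons {ys₁ = ys₁} p q r) s with ~-remove ys₁ s
... | zs₁ , _ , _ , _ , refl , p′ , q′ , s′ = cons {ys₁ = zs₁} (≈-trans p p′) (≈-trans q q′) (~-trans r s′)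

~-++⁺ʳ : ∀ {xs xs′} ys → xs ~ xs′ → (xs ++ ys) ~ (xs′ ++ ys)
~-++⁺ʳ ys nil = ~-refl
~-++⁺ʳ ys (cons {P' = P′} {Q' = Q′} {ys₁ = a₁} {ys₂ = a₂} p q r) =
  ≡.subst (_ ~_) (sym (++-assoc a₁ ((P′ , Q′) ∷ a₂) ys))
    (cons {ys₁ = a₁} p q (≡.subst (_ ~_) (++-assoc a₁ a₂ ys) (~-++⁺ʳ ys r)))

~-++⁺ˡ : ∀ xs {ys ys′} → ys ~ ys′ → (xs ++ ys) ~ (xs ++ ys′)
~-++⁺ˡ []       r = r
~-++⁺ˡ (_ ∷ xs) r = cons {ys₁ = []} ≈-refl ≈-refl (~-++⁺ˡ xs r)

~-++-comm : ∀ xs ys → (xs ++ ys) ~ (ys ++ xs)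
~-++-comm []       ys = ~-reflexive (sym (++-identityʳ ys))
~-++-comm (_ ∷ xs) ys = cons {ys₁ = ys} ≈-refl ≈-refl (~-++-comm xs ys)

⊎ᵗ-cong : ∀ {A A′ B B′} → A ≈ A′ → B ≈ B′ → (A ⊎ᵗ B) ≈ (A′ ⊎ᵗ B′)
⊎ᵗ-cong {⟨ _ ⟩} {⟨ xs′ ⟩} {⟨ ys ⟩} (mset r) (mset s) = mset (~-trans (~-++⁺ʳ ys r) (~-++⁺ˡ xs′ s))

⊎ᵗ-comm : ∀ A B → (A ⊎ᵗ B) ≈ (B ⊎ᵗ A)
⊎ᵗ-comm ⟨ xs ⟩ ⟨ ys ⟩ = mset (~-++-comm xs ys)

⊎ᵗ-assoc : ∀ A B C → ((A ⊎ᵗ B) ⊎ᵗ C) ≈ (A ⊎ᵗ (B ⊎ᵗ C))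
⊎ᵗ-assoc ⟨ xs ⟩ ⟨ ys ⟩ ⟨ zs ⟩ = mset (~-reflexive (++-assoc xs ys zs))

⊎ᵗ-identityˡ : ∀ A → (𝟎 ⊎ᵗ A) ≡ A
⊎ᵗ-identityˡ ⟨ _ ⟩ = refl

⊎ᵗ-commutativeMonoid : CommutativeMonoid _ _
⊎ᵗ-commutativeMonoid = record
  { isCommutativeMonoid = isCommutativeMonoidˡ record
    { isSemigroup = record
      { isMagma = record
        { isEquivalence = record { refl = ≈-refl ; sym = ≈-sym ; trans = ≈-trans }
        ; ∙-cong        = ⊎ᵗ-cong
        }
      ; assoc = ⊎ᵗ-assoc
      }
    ; identityˡ = λ A → ≈-reflexive (⊎ᵗ-identityˡ A)
    ; comm      = ⊎ᵗ-comm
    }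
  }

⊎ᵉ-commutativeMonoid : CommutativeMonoid _ _
⊎ᵉ-commutativeMonoid = Pointwise.commutativeMonoid ℕ ⊎ᵗ-commutativeMonoid

open CommutativeMonoid ⊎ᵗ-commutativeMonoid
  using () renaming (identityʳ to ⊎ᵗ-identityʳ)
open CommutativeMonoid ⊎ᵉ-commutativeMonoid
  using ()
  renaming ( refl to ≈ᵉ-refl; sym to ≈ᵉ-sym; trans to ≈ᵉ-trans
           ; ∙-cong to ⊎ᵉ-cong; ∙-congˡ to ⊎ᵉ-congˡ; ∙-congʳ to ⊎ᵉ-congʳ
           ; assoc to ⊎ᵉ-assoc; identityˡ to ⊎ᵉ-identityˡ; identityʳ to ⊎ᵉ-identityʳ)
open CommutativeSemigroupProperties (CommutativeMonoid.commutativeSemigroup ⊎ᵉ-commutativeMonoid)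
  using ()
  renaming (interchange to ⊎ᵉ-interchange; x∙yz≈y∙xz to ⊎ᵉ-left-comm; xy∙z≈xz∙y to ⊎ᵉ-right-comm)

~-[]-inv : ∀ {xs} → [] ~ xs → xs ≡ []
~-[]-inv nil = refl

≈-𝟎-inv : ∀ {A} → A ≈ 𝟎 → A ≡ 𝟎
≈-𝟎-inv (mset r) with ~-[]-inv (~-sym r)
... | refl = refl

≈-singleton-inv : ∀ {A P Q} → A ≈ ⟨ (P , Q) ∷ [] ⟩ →
  Σ[ P′ ∈ Ty ] Σ[ Q′ ∈ Ty ] (A ≡ ⟨ (P′ , Q′) ∷ [] ⟩) × (P′ ≈ P) × (Q′ ≈ Q)
≈-singleton-inv (mset r) with ~-sym r
... | cons {ys₁ = ys₁} {ys₂ = ys₂} p q r′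
  with ++-conicalˡ ys₁ ys₂ (~-[]-inv r′) | ++-conicalʳ ys₁ ys₂ (~-[]-inv r′)
... | refl | refl = _ , _ , refl , ≈-sym p , ≈-sym q

tabulate-~ : ∀ {n} {Ps Ps′ Qs Qs′ : Fin n → Ty} → (∀ i → Ps i ≈ Ps′ i) → (∀ i → Qs i ≈ Qs′ i) →
  tabulate (λ i → (Ps i , Qs i)) ~ tabulate (λ i → (Ps′ i , Qs′ i))
tabulate-~ {zero}  p q = nil
tabulate-~ {suc n} p q = cons {ys₁ = []} (p zero) (q zero) (tabulate-~ (p ∘ suc) (q ∘ suc))

≗⇒≈ᵉ : ∀ {Γ Δ} → Γ ≗ Δ → Γ ≈ᵉ Δ
≗⇒≈ᵉ eq n = ≈-reflexive (eq n)

single-≡ : ∀ x P → single x P x ≡ P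
single-≡ x P with x ≟ x
... | yes _  = refl
... | no x≢x = ⊥-elim (x≢x refl)

single-≢ : ∀ {x n} P → n ≢ x → single x P n ≡ 𝟎
single-≢ {x} {n} P n≢x with n ≟ x
... | yes n≡x = ⊥-elim (n≢x n≡x)
... | no _    = refl

single-suc-zero : ∀ x P → single (suc x) P zero ≡ 𝟎
single-suc-zero x P = single-≢ {suc x} {zero} P (λ ())

single-zero-suc : ∀ P → tailᵉ (single zero P) ≗ ∅
single-zero-suc P n = single-≢ {zero} {suc n} P (λ ())

single-suc : ∀ x P → tailᵉ (single (suc x) P) ≗ single x P
single-suc x P n = by-cases (n ≟ x)
  where
  by-cases : Dec (n ≡ x) → single (suc x) P (suc n) ≡ single x P n
  by-cases (yes refl) = trans (single-≡ (suc x) P) (sym (single-≡ x P))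
  by-cases (no n≢x)   = trans (single-≢ P (n≢x ∘ suc-injective)) (sym (single-≢ P n≢x))

single-𝟎 : ∀ x → single x 𝟎 ≗ ∅
single-𝟎 x n with n ≟ x
... | yes _ = refl
... | no _  = refl

single-⊎ : ∀ x A B → single x (A ⊎ᵗ B) ≗ (single x A ⊎ᵉ single x B)
single-⊎ x A B n with n ≟ x
... | yes _ = refl
... | no _  = refl

single-cong : ∀ x {P P′} → P ≈ P′ → single x P ≈ᵉ single x P′
single-cong x P≈ n with n ≟ x
... | yes _ = P≈
... | no _  = ≈-refl

⨄-cong : ∀ n {Γs Δs : Fin n → Env} → (∀ i → Γs i ≈ᵉ Δs i) → ⨄ n Γs ≈ᵉ ⨄ n Δs
⨄-cong zero    eq = ≈ᵉ-refl
⨄-cong (suc n) eq = ⊎ᵉ-cong (eq zero) (⨄-cong n (eq ∘ suc))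

⨄-⊎ᵉ : ∀ n (Γs Δs : Fin n → Env) → ⨄ n (λ i → Γs i ⊎ᵉ Δs i) ≈ᵉ (⨄ n Γs ⊎ᵉ ⨄ n Δs)
⨄-⊎ᵉ zero    Γs Δs = ≈ᵉ-sym (⊎ᵉ-identityʳ ∅)
⨄-⊎ᵉ (suc n) Γs Δs = ≈ᵉ-trans (⊎ᵉ-congˡ (⨄-⊎ᵉ n (Γs ∘ suc) (Δs ∘ suc))) (⊎ᵉ-interchange _ _ _ _)

⨄-homomorphic : (f : Env → Env) → f ∅ ≗ ∅ → (∀ Γ Δ → f (Γ ⊎ᵉ Δ) ≗ (f Γ ⊎ᵉ f Δ)) →
  ∀ n (Γs : Fin n → Env) → f (⨄ n Γs) ≗ ⨄ n (f ∘ Γs)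
⨄-homomorphic f f-∅ f-⊎ zero    Γs m = f-∅ m
⨄-homomorphic f f-∅ f-⊎ (suc n) Γs m =
  trans (f-⊎ (Γs zero) _ m) (cong (f (Γs zero) m ⊎ᵗ_) (⨄-homomorphic f f-∅ f-⊎ n (Γs ∘ suc) m))

⨄ᵗ : (n : ℕ) → (Fin n → Ty) → Ty
⨄ᵗ zero    As = 𝟎
⨄ᵗ (suc n) As = As zero ⊎ᵗ ⨄ᵗ n (As ∘ suc)

⨄-apply : ∀ n (Γs : Fin n → Env) x → ⨄ n Γs x ≡ ⨄ᵗ n (λ i → Γs i x)
⨄-apply zero    Γs x = refl
⨄-apply (suc n) Γs x = cong (Γs zero x ⊎ᵗ_) (⨄-apply n (Γs ∘ suc) x)

sumFin-cong : ∀ n {f g : Fin n → ℕ} → (∀ i → f i ≡ g i) → sumFin n f ≡ sumFin n g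
sumFin-cong zero    eq = refl
sumFin-cong (suc n) eq = cong₂ _+_ (eq zero) (sumFin-cong n (eq ∘ suc))

sumFin-+ : ∀ n (f g : Fin n → ℕ) → sumFin n (λ i → f i + g i) ≡ sumFin n f + sumFin n g
sumFin-+ zero    f g = refl
sumFin-+ (suc n) f g = trans (cong (f zero + g zero +_) (sumFin-+ n (f ∘ suc) (g ∘ suc)))
                             (+-interchange (f zero) (g zero) _ _)

punchIn : ℕ → ℕ → ℕ
punchIn zero    n       = suc n
punchIn (suc k) zero    = zero
punchIn (suc k) (suc n) = suc (punchIn k n)

punchInᵉ : ℕ → Env → Env
punchInᵉ zero    Γ zero    = 𝟎
punchInᵉ zero    Γ (suc n) = Γ n
punchInᵉ (suc k) Γ zero    = Γ zero
punchInᵉ (suc k) Γ (suc n) = punchInᵉ k (tailᵉ Γ) n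

punchInᵉ-cong : ∀ (_∼_ : Ty → Ty → Set) k {Γ Δ} → 𝟎 ∼ 𝟎 → (∀ n → Γ n ∼ Δ n) →
                ∀ n → punchInᵉ k Γ n ∼ punchInᵉ k Δ n
punchInᵉ-cong _∼_ zero    𝟎∼𝟎 eq zero    = 𝟎∼𝟎
punchInᵉ-cong _∼_ zero    𝟎∼𝟎 eq (suc n) = eq n
punchInᵉ-cong _∼_ (suc k) 𝟎∼𝟎 eq zero    = eq zero
punchInᵉ-cong _∼_ (suc k) 𝟎∼𝟎 eq (suc n) = punchInᵉ-cong _∼_ k 𝟎∼𝟎 (eq ∘ suc) n

punchInᵉ-∅ : ∀ k → punchInᵉ k ∅ ≗ ∅
punchInᵉ-∅ zero    zero    = refl
punchInᵉ-∅ zero    (suc n) = refl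
punchInᵉ-∅ (suc k) zero    = refl
punchInᵉ-∅ (suc k) (suc n) = punchInᵉ-∅ k n

punchInᵉ-⊎ : ∀ k Γ Δ → punchInᵉ k (Γ ⊎ᵉ Δ) ≗ (punchInᵉ k Γ ⊎ᵉ punchInᵉ k Δ)
punchInᵉ-⊎ zero    Γ Δ zero    = refl
punchInᵉ-⊎ zero    Γ Δ (suc n) = refl
punchInᵉ-⊎ (suc k) Γ Δ zero    = refl
punchInᵉ-⊎ (suc k) Γ Δ (suc n) = punchInᵉ-⊎ k (tailᵉ Γ) (tailᵉ Δ) n

punchInᵉ-⨄ : ∀ k n (Γs : Fin n → Env) → punchInᵉ k (⨄ n Γs) ≗ ⨄ n (punchInᵉ k ∘ Γs)
punchInᵉ-⨄ k = ⨄-homomorphic (punchInᵉ k) (punchInᵉ-∅ k) (punchInᵉ-⊎ k)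

single-punchIn : ∀ k x P → single (punchIn k x) P ≗ punchInᵉ k (single x P)
single-punchIn zero    x       P zero    = single-suc-zero x P
single-punchIn zero    x       P (suc n) = single-suc x P n
single-punchIn (suc k) zero    P zero    = refl
single-punchIn (suc k) (suc x) P zero    = trans (single-suc-zero (punchIn k x) P) (sym (single-suc-zero x P))
single-punchIn (suc k) zero    P (suc n) =
  sym (trans (punchInᵉ-cong _≡_ k refl (single-zero-suc P) n) (punchInᵉ-∅ k n))
single-punchIn (suc k) (suc x) P (suc n) =
  trans (single-suc (punchIn k x) P n)
        (trans (single-punchIn k x P n) (punchInᵉ-cong _≡_ k refl (sym ∘ single-suc x P) n))

-- Only punchOut k n with n ≢ k matters; the value at n = k is arbitrary.
punchOut : ℕ → ℕ → ℕ
punchOut zero    zero    = zero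
punchOut zero    (suc n) = n
punchOut (suc k) zero    = zero
punchOut (suc k) (suc n) = suc (punchOut k n)

punchOutᵉ : ℕ → Env → Env
punchOutᵉ zero    Γ         = tailᵉ Γ
punchOutᵉ (suc k) Γ zero    = Γ zero
punchOutᵉ (suc k) Γ (suc n) = punchOutᵉ k (tailᵉ Γ) n

punchOutᵉ-cong : ∀ k {Γ Δ} → Γ ≗ Δ → punchOutᵉ k Γ ≗ punchOutᵉ k Δ
punchOutᵉ-cong zero    eq n       = eq (suc n)
punchOutᵉ-cong (suc k) eq zero    = eq zero
punchOutᵉ-cong (suc k) eq (suc n) = punchOutᵉ-cong k (eq ∘ suc) n

punchOutᵉ-∅ : ∀ k → punchOutᵉ k ∅ ≗ ∅
punchOutᵉ-∅ zero    n       = refl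
punchOutᵉ-∅ (suc k) zero    = refl
punchOutᵉ-∅ (suc k) (suc n) = punchOutᵉ-∅ k n

punchOutᵉ-⊎ : ∀ k Γ Δ → punchOutᵉ k (Γ ⊎ᵉ Δ) ≗ (punchOutᵉ k Γ ⊎ᵉ punchOutᵉ k Δ)
punchOutᵉ-⊎ zero    Γ Δ n       = refl
punchOutᵉ-⊎ (suc k) Γ Δ zero    = refl
punchOutᵉ-⊎ (suc k) Γ Δ (suc n) = punchOutᵉ-⊎ k (tailᵉ Γ) (tailᵉ Δ) n

punchOutᵉ-⨄ : ∀ k n (Γs : Fin n → Env) → punchOutᵉ k (⨄ n Γs) ≗ ⨄ n (punchOutᵉ k ∘ Γs)
punchOutᵉ-⨄ k = ⨄-homomorphic (punchOutᵉ k) (punchOutᵉ-∅ k) (punchOutᵉ-⊎ k)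

punchOutᵉ-single-≡ : ∀ k P → punchOutᵉ k (single k P) ≗ ∅
punchOutᵉ-single-≡ zero    P n       = single-zero-suc P n
punchOutᵉ-single-≡ (suc k) P zero    = single-suc-zero k P
punchOutᵉ-single-≡ (suc k) P (suc n) = trans (punchOutᵉ-cong k (single-suc k P) n) (punchOutᵉ-single-≡ k P n)

punchOutᵉ-single-≢ : ∀ k x P → x ≢ k → punchOutᵉ k (single x P) ≗ single (punchOut k x) P
punchOutᵉ-single-≢ zero    zero    P x≢k n       = ⊥-elim (x≢k refl)
punchOutᵉ-single-≢ zero    (suc x) P x≢k n       = single-suc x P n
punchOutᵉ-single-≢ (suc k) zero    P x≢k zero    = refl
punchOutᵉ-single-≢ (suc k) zero    P x≢k (suc n) =
  trans (punchOutᵉ-cong k (single-zero-suc P) n) (trans (punchOutᵉ-∅ k n) (sym (single-zero-suc P n)))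
punchOutᵉ-single-≢ (suc k) (suc x) P x≢k zero    =
  trans (single-suc-zero x P) (sym (single-suc-zero (punchOut k x) P))
punchOutᵉ-single-≢ (suc k) (suc x) P x≢k (suc n) =
  trans (punchOutᵉ-cong k (single-suc x P) n)
        (trans (punchOutᵉ-single-≢ k x P (x≢k ∘ cong suc) n) (sym (single-suc (punchOut k x) P n)))

record Derivable (Γ : Env) (t : Term) (Q : Ty) (s : ℕ) : Set where
  constructor derivable
  field
    {Γ′}       : Env
    {Q′}       : Ty
    derivation : Γ′ ⊢ t ∶ Q′
    env≈       : Γ′ ≈ᵉ Γ
    type≈      : Q′ ≈ Q
    size≡      : size derivation ≡ s

exact : ∀ {Γ t Q} (π : Γ ⊢ t ∶ Q) → Derivable Γ t Q (size π)
exact π = derivable π ≈ᵉ-refl ≈-refl refl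

Derivable-cong : ∀ {Γ Γ₂ t Q Q₂ s s₂} → Γ ≈ᵉ Γ₂ → Q ≈ Q₂ → s ≡ s₂ →
                 Derivable Γ t Q s → Derivable Γ₂ t Q₂ s₂
Derivable-cong Γ≈ Q≈ refl (derivable π Γ′≈ Q′≈ s≡) = derivable π (≈ᵉ-trans Γ′≈ Γ≈) (≈-trans Q′≈ Q≈) s≡

Derivable-≡ : ∀ {Γ t t′ Q s} → t ≡ t′ → Derivable Γ t Q s → Derivable Γ t′ Q s
Derivable-≡ refl D = D

app≈ : ∀ {Γ Δ t u P P′ Q s s′} → Derivable Γ t ⟨ (P , Q) ∷ [] ⟩ s → Derivable Δ u P′ s′ → P ≈ P′ →
       Derivable (Γ ⊎ᵉ Δ) (app t u) Q (suc (s + s′))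
app≈ (derivable d Γ≈ F≈ refl) (derivable e Δ≈ P′≈ refl) P≈ with ≈-singleton-inv F≈
... | _ , _ , refl , P″≈ , Q″≈ =
  derivable (ap d e (≈-trans P″≈ (≈-trans P≈ (≈-sym P′≈)))) (⊎ᵉ-cong Γ≈ Δ≈) Q″≈ refl

lam-⨄ : ∀ {b} n {Δs : Fin n → Env} {Qs : Fin n → Ty} {ss : Fin n → ℕ} →
        (∀ i → Derivable (Δs i) b (Qs i) (ss i)) →
        Derivable (⨄ n (tailᵉ ∘ Δs)) (lam b) ⟨ tabulate (λ i → (Δs i zero , Qs i)) ⟩ (sumFin n ss)
lam-⨄ n Ds = derivable (lm n _ _ (Derivable.derivation ∘ Ds))
  (⨄-cong n (λ i m → Derivable.env≈ (Ds i) (suc m)))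
  (mset (tabulate-~ (λ i → Derivable.env≈ (Ds i) zero) (Derivable.type≈ ∘ Ds)))
  (sumFin-cong n (Derivable.size≡ ∘ Ds))

lam≈ : ∀ {Δ b Q s} → Derivable Δ b Q s → Derivable (tailᵉ Δ) (lam b) ⟨ (Δ zero , Q) ∷ [] ⟩ s
lam≈ {s = s} D = Derivable-cong (⊎ᵉ-identityʳ _) ≈-refl (+-identityʳ s) (lam-⨄ 1 (λ _ → D))

ext-cong : ∀ {ρ ρ′ : Ren} → ρ ≗ ρ′ → ext ρ ≗ ext ρ′
ext-cong eq zero    = refl
ext-cong eq (suc n) = cong suc (eq n)

rename-cong : ∀ {ρ ρ′ : Ren} → ρ ≗ ρ′ → ∀ t → rename ρ t ≡ rename ρ′ t
rename-cong eq (var n)   = cong var (eq n)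
rename-cong eq (lam t)   = cong lam (rename-cong (ext-cong eq) t)
rename-cong eq (app t u) = cong₂ app (rename-cong eq t) (rename-cong eq u)

ext-punchIn : ∀ k → ext (punchIn k) ≗ punchIn (suc k)
ext-punchIn k zero    = refl
ext-punchIn k (suc n) = refl

weakening : ∀ k {Γ t A} (π : Γ ⊢ t ∶ A) → Derivable (punchInᵉ k Γ) (rename (punchIn k) t) A (size π)
weakening k (ax x P) = derivable (ax (punchIn k x) P) (≗⇒≈ᵉ (single-punchIn k x P)) ≈-refl refl
weakening k (ap d e P≈) =
  Derivable-cong (≗⇒≈ᵉ (sym ∘ punchInᵉ-⊎ k _ _)) ≈-refl refl (app≈ (weakening k d) (weakening k e) P≈)
weakening k (lm {t = b} n Δs Qs ds) =
  Derivable-≡ (cong lam (rename-cong (sym ∘ ext-punchIn k) b))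
    (Derivable-cong (≗⇒≈ᵉ (sym ∘ punchInᵉ-⨄ k n _)) ≈-refl refl
      (lam-⨄ n (λ i → weakening (suc k) (ds i))))

weaken : ∀ {Γ t A s} → Derivable Γ t A s → Derivable (punchInᵉ zero Γ) (shift t) A s
weaken (derivable π Γ≈ A≈ refl) =
  Derivable-cong (punchInᵉ-cong _≈_ zero ≈-refl Γ≈) A≈ refl (weakening zero π)

record Split (Θ : Env) (v : Term) (A B : Ty) (s : ℕ) : Set where
  constructor split
  field
    {Θ₁ Θ₂} : Env
    {s₁ s₂} : ℕ
    left    : Derivable Θ₁ v A s₁
    right   : Derivable Θ₂ v B s₂
    env≈    : (Θ₁ ⊎ᵉ Θ₂) ≈ᵉ Θ
    size≡   : s₁ + s₂ ≡ s

lam-cons : ∀ {Δ Γ b Q P Q′ s} ys₁ {ys₂} (d : Δ ⊢ b ∶ Q) → Derivable Γ (lam b) ⟨ ys₁ ++ ys₂ ⟩ s →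
           Δ zero ≈ P → Q ≈ Q′ → Derivable (tailᵉ Δ ⊎ᵉ Γ) (lam b) ⟨ ys₁ ++ (P , Q′) ∷ ys₂ ⟩ (size d + s)
lam-cons {Δ} {Q = Q} ys₁ d (derivable (lm n Δs Qs ds) Γ≈ (mset r) refl) P≈ Q≈ =
  derivable (lm (suc n) (Δ ∷ᶠ Δs) (Q ∷ᶠ Qs) λ { zero → d ; (suc i) → ds i })
    (⊎ᵉ-congˡ Γ≈) (mset (cons {ys₁ = ys₁} P≈ Q≈ r)) refl

middle-in-++ : ∀ {A : Set} (ys₁ ys₂ as bs : List A) (y : A) → ys₁ ++ y ∷ ys₂ ≡ as ++ bs →
  (Σ[ a₁ ∈ List A ] Σ[ a₂ ∈ List A ] (as ≡ a₁ ++ y ∷ a₂) × (ys₁ ++ ys₂ ≡ (a₁ ++ a₂) ++ bs))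
  ⊎ (Σ[ b₁ ∈ List A ] Σ[ b₂ ∈ List A ] (bs ≡ b₁ ++ y ∷ b₂) × (ys₁ ++ ys₂ ≡ as ++ (b₁ ++ b₂)))
middle-in-++ ys₁ ys₂ [] bs y eq = inj₂ (ys₁ , ys₂ , sym eq , refl)
middle-in-++ [] ys₂ (a ∷ as) bs y eq with ∷-injective eq
... | refl , eq′ = inj₁ ([] , as , refl , eq′)
middle-in-++ (x ∷ ys₁) ys₂ (a ∷ as) bs y eq with ∷-injective eq
... | refl , eq′ with middle-in-++ ys₁ ys₂ as bs y eq′
... | inj₁ (a₁ , a₂ , eq₁ , eq₂) = inj₁ (x ∷ a₁ , a₂ , cong (x ∷_) eq₁ , cong (x ∷_) eq₂)
... | inj₂ (b₁ , b₂ , eq₁ , eq₂) = inj₂ (b₁ , b₂ , eq₁ , cong (x ∷_) eq₂)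

-- Each premise of the λ rule contributes its pair to the left or to the right half.
lam-split : ∀ {Γ b zs M} as bs (π : Γ ⊢ lam b ∶ ⟨ zs ⟩) → zs ~ M → M ≡ as ++ bs →
            Split Γ (lam b) ⟨ as ⟩ ⟨ bs ⟩ (size π)
lam-split as bs π@(lm zero _ _ _) nil eq with ++-conicalˡ as bs (sym eq) | ++-conicalʳ as bs (sym eq)
... | refl | refl = split (exact π) (exact π) ≈ᵉ-refl refl
lam-split as bs (lm (suc n) Δs Qs ds) (cons {ys₁ = ys₁} {ys₂ = ys₂} P≈ Q≈ r) eq
  with middle-in-++ ys₁ ys₂ as bs _ eq
... | inj₁ (a₁ , a₂ , refl , eq′) with lam-split (a₁ ++ a₂) bs (lm n (Δs ∘ suc) (Qs ∘ suc) (ds ∘ suc)) r eq′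
...   | split L R env≈ size≡ =
  split (lam-cons a₁ (ds zero) L P≈ Q≈) R (≈ᵉ-trans (⊎ᵉ-assoc _ _ _) (⊎ᵉ-congˡ env≈))
        (trans (+-assoc (size (ds zero)) _ _) (cong (size (ds zero) +_) size≡))
lam-split as bs (lm (suc n) Δs Qs ds) (cons {ys₁ = ys₁} {ys₂ = ys₂} P≈ Q≈ r) eq
    | inj₂ (b₁ , b₂ , refl , eq′) with lam-split as (b₁ ++ b₂) (lm n (Δs ∘ suc) (Qs ∘ suc) (ds ∘ suc)) r eq′
...   | split {s₁ = s₁} {s₂} L R env≈ size≡ =
  split L (lam-cons b₁ (ds zero) R P≈ Q≈) (≈ᵉ-trans (⊎ᵉ-left-comm _ _ _) (⊎ᵉ-congˡ env≈))
        (trans (+-left-comm s₁ (size (ds zero)) s₂) (cong (size (ds zero) +_) size≡))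

value-split : ∀ {Θ v A B s} → Value v → Derivable Θ v (A ⊎ᵗ B) s → Split Θ v A B s
value-split {A = A} {B} (vVar _) (derivable (ax y P) Θ≈ P≈ refl) =
  split (exact (ax y A)) (exact (ax y B))
    (≈ᵉ-trans (≗⇒≈ᵉ (sym ∘ single-⊎ y A B)) (≈ᵉ-trans (single-cong y (≈-sym P≈)) Θ≈)) refl
value-split {A = ⟨ as ⟩} {⟨ bs ⟩} (vLam _) (derivable π Θ≈ (mset r) refl) with lam-split as bs π r refl
... | split L R env≈ size≡ = split L R (≈ᵉ-trans env≈ Θ≈) size≡

value-split-𝟎 : ∀ {Θ v s} → Value v → Derivable Θ v 𝟎 s → (∅ ≈ᵉ Θ) × (0 ≡ s)
value-split-𝟎 (vVar _) (derivable (ax y P) Θ≈ P≈ refl) with ≈-𝟎-inv P≈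
... | refl = ≈ᵉ-trans (≗⇒≈ᵉ (sym ∘ single-𝟎 y)) Θ≈ , refl
value-split-𝟎 (vLam _) (derivable (lm zero _ _ _) Θ≈ _ refl) = Θ≈ , refl
value-split-𝟎 (vLam _) (derivable (lm (suc n) _ _ _) _ Q≈ _) with ≈-𝟎-inv Q≈
... | ()

record Splitⁿ (n : ℕ) (Θ : Env) (v : Term) (As : Fin n → Ty) (s : ℕ) : Set where
  constructor splitⁿ
  field
    {Θs}  : Fin n → Env
    {ss}  : Fin n → ℕ
    parts : ∀ i → Derivable (Θs i) v (As i) (ss i)
    env≈  : ⨄ n Θs ≈ᵉ Θ
    size≡ : sumFin n ss ≡ s

value-split-⨄ : ∀ n {Θ v As s} → Value v → Derivable Θ v (⨄ᵗ n As) s → Splitⁿ n Θ v As s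
value-split-⨄ zero val D with value-split-𝟎 val D
... | ∅≈ , 0≡ = splitⁿ {Θs = λ ()} {ss = λ ()} (λ ()) ∅≈ 0≡
value-split-⨄ (suc n) val D with value-split val D
... | split {Θ₁} {s₁ = s₁} L R env≈ size≡ with value-split-⨄ n val R
... | splitⁿ {Θs} {ss} parts env≈′ size≡′ =
  splitⁿ {Θs = Θ₁ ∷ᶠ Θs} {ss = s₁ ∷ᶠ ss} (λ { zero → L ; (suc i) → parts i })
    (≈ᵉ-trans (⊎ᵉ-congˡ env≈′) env≈) (trans (cong (s₁ +_) size≡′) size≡)

record SubstitutesAt (σ : Sub) (k : ℕ) (w : Term) : Set where
  field
    at        : σ k ≡ w
    elsewhere : ∀ {n} → n ≢ k → σ n ≡ var (punchOut k n)
open SubstitutesAt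

exts-substitutesAt : ∀ {σ k w} → SubstitutesAt σ k w → SubstitutesAt (exts σ) (suc k) (shift w)
exts-substitutesAt σ-at = record
  { at        = cong shift (at σ-at)
  ; elsewhere = λ { {zero} _ → refl ; {suc n} n≢k → cong shift (elsewhere σ-at (n≢k ∘ cong suc)) }
  }

[]-substitutesAt : ∀ t v → Σ[ σ ∈ Sub ] (t [ v ] ≡ subst σ t) × SubstitutesAt σ zero v
[]-substitutesAt t v = _ , refl , record
  { at        = refl
  ; elsewhere = λ { {zero} 0≢0 → ⊥-elim (0≢0 refl) ; {suc n} _ → refl }
  }

shift-value : ∀ {v} → Value v → Value (shift v)
shift-value (vVar n) = vVar (suc n)
shift-value (vLam t) = vLam _

substitution : ∀ {σ k w} → SubstitutesAt σ k w → Value w →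
  ∀ {Δ t Q Θ s} (π : Δ ⊢ t ∶ Q) → Derivable Θ w (Δ k) s →
  Derivable (punchOutᵉ k Δ ⊎ᵉ Θ) (subst σ t) Q (size π + s)
substitution {k = k} σ-at val (ax x P) ρ with x ≟ k
... | yes refl =
  Derivable-≡ (sym (at σ-at))
    (Derivable-cong (≈ᵉ-sym (≈ᵉ-trans (⊎ᵉ-congʳ (≗⇒≈ᵉ (punchOutᵉ-single-≡ x P))) (⊎ᵉ-identityˡ _)))
                    (≈-reflexive (single-≡ x P)) refl ρ)
... | no x≢k with value-split-𝟎 val (Derivable-cong ≈ᵉ-refl (≈-reflexive (single-≢ P (x≢k ∘ sym))) refl ρ)
...   | ∅≈Θ , 0≡s =
  Derivable-≡ (sym (elsewhere σ-at x≢k))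
    (Derivable-cong (≈ᵉ-trans (≗⇒≈ᵉ (sym ∘ punchOutᵉ-single-≢ k x P x≢k))
                              (≈ᵉ-trans (≈ᵉ-sym (⊎ᵉ-identityʳ _)) (⊎ᵉ-congˡ ∅≈Θ)))
                    ≈-refl 0≡s (exact (ax (punchOut k x) P)))
substitution {k = k} σ-at val (ap {Γ = Δ₁} {Δ = Δ₂} d e P≈) ρ with value-split val ρ
... | split {s₁ = s₁} {s₂} L R env≈ refl =
  Derivable-cong
    (≈ᵉ-trans (⊎ᵉ-interchange _ _ _ _) (⊎ᵉ-cong (≗⇒≈ᵉ (sym ∘ punchOutᵉ-⊎ k Δ₁ Δ₂)) env≈))
    ≈-refl (cong suc (+-interchange (size d) s₁ (size e) s₂))
    (app≈ (substitution σ-at val d L) (substitution σ-at val e R) P≈)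
substitution {k = k} σ-at val (lm n Δs Qs ds) ρ
  with value-split-⨄ n val (Derivable-cong ≈ᵉ-refl (≈-reflexive (⨄-apply n (tailᵉ ∘ Δs) k)) refl ρ)
... | splitⁿ {Θs} {ss} parts env≈ refl =
  Derivable-cong
    (≈ᵉ-trans (⨄-⊎ᵉ n (punchOutᵉ k ∘ tailᵉ ∘ Δs) Θs)
      (⊎ᵉ-cong (≗⇒≈ᵉ (sym ∘ punchOutᵉ-⨄ k n (tailᵉ ∘ Δs))) env≈))
    (mset (tabulate-~ (λ i → ⊎ᵗ-identityʳ (Δs i zero)) (λ _ → ≈-refl)))
    (sumFin-+ n (size ∘ ds) ss)
    (lam-⨄ n (λ i → substitution (exts-substitutesAt σ-at) (shift-value val) (ds i) (weaken (parts i))))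

record LamPremise (Γ : Env) (b : Term) (P Q : Ty) (n : ℕ) : Set where
  constructor premise
  field
    {Δ}    : Env
    body   : Δ ⊢ b ∶ Q
    bound≡ : Δ zero ≡ P
    env≈   : tailᵉ Δ ≈ᵉ Γ
    size≡  : size body ≡ n

lam-inversion : ∀ {Γ b P Q} (d : Γ ⊢ lam b ∶ ⟨ (P , Q) ∷ [] ⟩) → LamPremise Γ b P Q (size d)
lam-inversion d = invert d refl
  where
  invert : ∀ {Γ b A P Q} (d : Γ ⊢ lam b ∶ A) → A ≡ ⟨ (P , Q) ∷ [] ⟩ → LamPremise Γ b P Q (size d)
  invert (lm 1 Δs Qs ds) refl = premise (ds zero) refl (≈ᵉ-sym (⊎ᵉ-identityʳ _)) (sym (+-identityʳ _))

Reduct : ℕ → Env → Term → Ty → ℕ → Set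
Reduct c Γ t Q n = Σ[ s ∈ ℕ ] Derivable Γ t Q s × (c + s ≡ n)

SubjectReduction : (Term → Term → Set) → ℕ → Set
SubjectReduction R c = ∀ {Γ t t′ Q} (π : Γ ⊢ t ∶ Q) → R t t′ → Reduct c Γ t′ Q (size π)

reduct-appˡ : ∀ {c Γ Δ t u P P′ Q n} → Reduct c Γ t ⟨ (P , Q) ∷ [] ⟩ n → (e : Δ ⊢ u ∶ P′) → P ≈ P′ →
              Reduct c (Γ ⊎ᵉ Δ) (app t u) Q (suc (n + size e))
reduct-appˡ {c} (s , D , refl) e P≈ =
  suc (s + size e) , app≈ D (exact e) P≈ , trans (+-suc c _) (cong suc (sym (+-assoc c s (size e))))

reduct-appʳ : ∀ {c Γ Δ t u P P′ Q n} (d : Γ ⊢ t ∶ ⟨ (P , Q) ∷ [] ⟩) → P ≈ P′ → Reduct c Δ u P′ n →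
              Reduct c (Γ ⊎ᵉ Δ) (app t u) Q (suc (size d + n))
reduct-appʳ {c} d P≈ (s , D , refl) =
  suc (size d + s) , app≈ (exact d) D P≈ , trans (+-suc c _) (cong suc (+-left-comm c (size d) s))

reduct-lam : ∀ {c Γ Δ b Q n n′} → tailᵉ Δ ≈ᵉ Γ → n ≡ n′ → Reduct c Δ b Q n →
             Reduct c Γ (lam b) ⟨ (Δ zero , Q) ∷ [] ⟩ n′
reduct-lam Δ≈ refl (s , D , refl) = s , Derivable-cong Δ≈ ≈-refl refl (lam≈ D) , refl

Balanced-subjectReduction : ∀ {R c} → SubjectReduction R c → SubjectReduction (Balanced R) c
Balanced-subjectReduction sr π (root r) = sr π r
Balanced-subjectReduction sr (ap d e P≈) (lamApp st) with lam-inversion d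
... | premise d₀ refl Δ≈ d₀≡ = reduct-appˡ (reduct-lam Δ≈ d₀≡ (Balanced-subjectReduction sr d₀ st)) e P≈
Balanced-subjectReduction sr (ap d e P≈) (appL st) = reduct-appˡ (Balanced-subjectReduction sr d st) e P≈
Balanced-subjectReduction sr (ap d e P≈) (appR st) = reduct-appʳ d P≈ (Balanced-subjectReduction sr e st)

βv-subjectReduction : SubjectReduction βv-root 1
βv-subjectReduction (ap d e P≈) (βv {t = b} {v} val) with lam-inversion d | []-substitutesAt b v
... | premise d₀ refl Δ≈ d₀≡ | σ , [v]≡ , σ-at =
  size d₀ + size e ,
  Derivable-≡ (sym [v]≡)
    (Derivable-cong (⊎ᵉ-congʳ Δ≈) ≈-refl refl
      (substitution σ-at val d₀ (Derivable-cong ≈ᵉ-refl (≈-sym P≈) refl (exact e)))) ,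
  cong (λ m → suc (m + size e)) d₀≡

σ-subjectReduction : SubjectReduction σ-root 0
σ-subjectReduction (ap (ap d e P≈) f R≈) σ₁ with lam-inversion d
... | premise d₀ refl Δ≈ d₀≡ =
  _ ,
  Derivable-cong (≈ᵉ-trans (⊎ᵉ-right-comm _ _ _) (⊎ᵉ-congʳ (⊎ᵉ-congʳ Δ≈))) ≈-refl size≡
    (app≈ (lam≈ (app≈ (exact d₀) (weakening zero f) R≈)) (exact e) (≈-trans (⊎ᵗ-identityʳ _) P≈)) ,
  refl
  where
  size≡ : suc (suc (size d₀ + size f) + size e) ≡ suc (suc (size d + size e) + size f)
  size≡ = trans (cong (λ a → suc (suc (a + size f) + size e)) d₀≡)
                (cong (2 +_) (+-right-comm (size d) (size f) (size e)))
-- σ₃ needs no typing fact about the value v.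
σ-subjectReduction (ap g (ap d e P≈) R≈) (σ₃ _) with lam-inversion d
... | premise d₀ refl Δ≈ d₀≡ =
  _ ,
  Derivable-cong (≈ᵉ-trans (⊎ᵉ-assoc _ _ _) (⊎ᵉ-congˡ (⊎ᵉ-congʳ Δ≈))) ≈-refl size≡
    (app≈ (lam≈ (app≈ (weakening zero g) (exact d₀) R≈)) (exact e)
          (≈-trans (≈-reflexive (⊎ᵗ-identityˡ _)) P≈)) ,
  refl
  where
  size≡ : suc (suc (size g + size d₀) + size e) ≡ suc (size g + suc (size d + size e))
  size≡ = trans (cong (λ a → suc (suc (size g + a) + size e)) d₀≡)
                (cong suc (trans (cong suc (+-assoc (size g) (size d) (size e))) (sym (+-suc (size g) _))))

Derivable⇒Σ : ∀ {Γ t Q s} → Derivable Γ t Q s →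
  Σ[ Γ′ ∈ Env ] Σ[ Q′ ∈ Ty ] Σ[ π′ ∈ Γ′ ⊢ t ∶ Q′ ] ((Γ′ ≈ᵉ Γ) × (Q′ ≈ Q) × (size π′ ≡ s))
Derivable⇒Σ (derivable π′ Γ≈ Q≈ s≡) = _ , _ , π′ , Γ≈ , Q≈ , s≡

Reduct⇒Derivable : ∀ {c Γ t Q n} → Reduct c Γ t Q n → Derivable Γ t Q (n ∸ c)
Reduct⇒Derivable {c} (s , D , refl) = Derivable-cong ≈ᵉ-refl ≈-refl (sym (m+n∸m≡n c s)) D

Reduct-size-pos : ∀ {Γ t Q n} → Reduct 1 Γ t Q n → 0 < n
Reduct-size-pos (_ , _ , refl) = s≤s z≤n

→σ-size-pos : ∀ {Γ t t′ Q} (π : Γ ⊢ t ∶ Q) → t →σ t′ → 0 < size π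
→σ-size-pos (ap _ _ _)   _         = s≤s z≤n
→σ-size-pos (ax _ _)     (root ())
→σ-size-pos (lm _ _ _ _) (root ())

mainTheorem9 : ∀ {Γ : Env} {t t' : Term} {Q : Ty} (π : Γ ⊢ t ∶ Q) →
    (t →βv t' → (0 < size π) ×
      (Σ[ Γ' ∈ Env ] Σ[ Q' ∈ Ty ] Σ[ π' ∈ Γ' ⊢ t' ∶ Q' ]
        ((Γ' ≈ᵉ Γ) × (Q' ≈ Q) × (size π' ≡ size π ∸ 1))))
    ×
    (t →σ t' → (0 < size π) ×
      (Σ[ Γ' ∈ Env ] Σ[ Q' ∈ Ty ] Σ[ π' ∈ Γ' ⊢ t' ∶ Q' ]
        ((Γ' ≈ᵉ Γ) × (Q' ≈ Q) × (size π' ≡ size π))))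
mainTheorem9 π =
  (λ step → let reduct = Balanced-subjectReduction βv-subjectReduction π step
            in Reduct-size-pos reduct , Derivable⇒Σ (Reduct⇒Derivable reduct)) ,
  (λ step → →σ-size-pos π step ,
            Derivable⇒Σ (Reduct⇒Derivable (Balanced-subjectReduction σ-subjectReduction π step)))
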